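{- Let $(\mathbf A,\mathbf B)$ be a pair of valued $\Sigma$-structures, $N$ a finite set, $c,s\in\mathbb Q$, $\kappa\in\mathbb Q_{\ge0}$, and $\Omega$ an $N$-ary $\kappa$-polymorphism of $(\mathbf A,\mathbf B,c,s)$. Then for every finite $\tau$-sorted set $X$, every payoff $\Sigma$-formula $\Phi$ over $X$, and every $M\in A^{X\times N}$ all of whose columns lie in $\mathrm{feas}(\Phi^{\mathbf A})$, $$\mathbb E_{f\sim\Omega^{\mathrm{out}}}\Phi^{\mathbf B}(f\circ\mathrm{rows}(M))-s\,w(\Phi)\ \ge\ \kappa\Big(\mathbb E_{n\sim\Omega^{\mathrm{in}}}\Phi^{\mathbf A}(\mathrm{col}_n(M))-c\,w(\Phi)\Big).$$ In particular, if $\mathbb E_{n\sim\Omega^{\mathrm{in}}}\Phi^{\mathbf A}(\mathrm{col}_n(M))\ge c\,w(\Phi)$ then $\mathbb E_{f\sim\Omega^{\mathrm{out}}}\Phi^{\mathbf B}(f\circ\mathrm{rows}(M))\ge s\,w(\Phi)$.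
   Context: Probability distributions are rational-valued; $\Delta N$ is the set of probability distributions on a finite set $N$. $\overline{\mathbb{Q}}=\mathbb{Q}\cup\{ -\infty\}$. Multi-sorted setting: fix a finite set $\tau$ of sorts. A $\tau$-sorted set is a set $A$ with $\mathrm{sort}:A\to\tau$, $A_t=\mathrm{sort}^{ -1}(t)$. For $\tau$-sorted $Z,A$, $A^Z$ is the set of sort-preserving maps $Z\to A$; for a plain finite set $N$, $A^N$ is the $\tau$-sorted set of maps $N\to A_t$ (sort $t$). An $N$-ary function from $A$ to $B$ is a sort-preserving $f:A^N\to B$. A matrix $M\in A^{Z\times N}$ has $M(z,n)\in A_{\mathrm{sort}(z)}$, columns $\mathrm{col}_n(M)\in A^Z$, rows $\mathrm{row}_z(M)\in A^N$; $f\circ\mathrm{rows}(M)$ is $z\mapsto f(\mathrm{row}_zM)$. A signature $\Sigma$: finite set $\sigma$ of symbols with arities $\mathrm{ar}(\phi)$ (finite $\tau$-sorted sets). A valued $\Sigma$-structure $\mathbf A$: finite $\tau$-sorted domain $A$, maps $\phi^{\mathbf A}:A^{\mathrm{ar}(\phi)}\to\overline{\mathbb Q}$ with nonempty $\mathrm{feas}(\phi^{\mathbf A})=(\phi^{\mathbf A})^{ -1}(\mathbb Q)$. A payoff formula over $X$: $\Phi=\sum_{i\in I}w_i\phi_i(\mathbf x_i)$, $I$ finite, $w_i\in\mathbb Q_{\ge0}$, $\phi_i\in\sigma$, $\mathbf x_i\in X^{\mathrm{ar}(\phi_i)}$; $w(\Phi)=\sum_iw_i$; $\Phi^{\mathbf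 A}(h)=\sum_iw_i\phi_i^{\mathbf A}(h\circ\mathbf x_i)$ for $h\in A^X$ with $0\cdot(-\infty)=-\infty$; $\mathrm{feas}(\Phi^{\mathbf A})=(\Phi^{\mathbf A})^{ -1}(\mathbb Q)$. $\mathrm{PolFeas}(\mathbf A,\mathbf B)^{(N)}$ is the set of $N$-ary functions $f$ from $A$ to $B$ with $f\circ\mathrm{rows}(M)\in\mathrm{feas}(\phi^{\mathbf B})$ whenever $M\in A^{\mathrm{ar}(\phi)\times N}$ has all columns in $\mathrm{feas}(\phi^{\mathbf A})$. An $N$-ary weighting is $\Omega=(\Omega^{\mathrm{in}}\in\Delta N,\Omega^{\mathrm{out}}\in\Delta\mathrm{PolFeas}(\mathbf A,\mathbf B)^{(N)})$. $\mathrm{Mat}_{\mathbf A}(N)$: pairs $(\phi,M)$ with $M\in A^{\mathrm{ar}(\phi)\times N}$, all columns in $\mathrm{feas}(\phi^{\mathbf A})$. $\Omega^{\mathrm{in}}[\phi,M]=\mathbb E_{n\sim\Omega^{\mathrm{in}}}\phi^{\mathbf A}(\mathrm{col}_nM)$, $\Omega^{\mathrm{out}}[\phi,M]=\mathbb E_{f\sim\Omega^{\mathrm{out}}}\phi^{\mathbf B}(f\circ\mathrm{rows}M)$. $\Omega$ is a $\kappa$-polymorphism of $(\mathbf A,\mathbf B,c,s)$ if $\Omega^{\mathrm{out}}[\phi,M]-s\ge\kappa(\Omega^{\mathrm{in}}[\phi,M]-c)$ for all $(\phi,M)\in\mathrm{Mat}_{\mathbf A}(N)$. -}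

module Defs where

open import Data.Nat using (ℕ)
open import Data.Fin using (Fin)
open import Data.Rational using (ℚ; 0ℚ; 1ℚ; _+_; _*_; -_; _≤_)
open import Data.List using (List; []; _∷_; map; foldr)
open import Data.List.Relation.Unary.All using (All)
open import Data.Product using (Σ; _×_; _,_; proj₁; proj₂)
open import Relation.Binary.PropositionalEquality using (_≡_)

data ℚ̄ : Set where
  fin : ℚ → ℚ̄
  -∞  : ℚ̄

infixl 6 _+̄_ _-ᵠ_
infixl 7 _·̄_
infix 4 _≤̄_ _≥̄_

_+̄_ : ℚ̄ → ℚ̄ → ℚ̄
fin a +̄ fin b = fin (a + b)
fin a +̄ -∞    = -∞
-∞    +̄ _     = -∞

-- scaling by a (nonnegative) rational, with 0 · (-∞) = -∞
_·̄_ : ℚ → ℚ̄ → ℚ̄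
w ·̄ fin a = fin (w * a)
w ·̄ -∞    = -∞

_-ᵠ_ : ℚ̄ → ℚ → ℚ̄
x -ᵠ q = x +̄ fin (- q)

data _≤̄_ : ℚ̄ → ℚ̄ → Set where
  -∞≤  : ∀ {x} → -∞ ≤̄ x
  fin≤ : ∀ {a b} → a ≤ b → fin a ≤̄ fin b

_≥̄_ : ℚ̄ → ℚ̄ → Set
x ≥̄ y = y ≤̄ x

-- x ∈ ℚ (i.e. x is feasible)
data IsFin : ℚ̄ → Set where
  isFin : ∀ a → IsFin (fin a)

record Dist (T : Set) : Set where
  field
    support : List (ℚ × T)
    nonneg  : All (λ p → 0ℚ ≤ proj₁ p) support
    total   : foldr _+_ 0ℚ (map proj₁ support) ≡ 1ℚ
open Dist public

𝔼 : {T : Set} → Dist T → (T → ℚ̄) → ℚ̄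
𝔼 D g = foldr (λ p acc → (proj₁ p ·̄ g (proj₂ p)) +̄ acc) (fin 0ℚ) (support D)

-- Multi-sorted setting over the finite set of sorts  Fin t.
-- A finite τ-sorted set is given (up to isomorphism) by the size of
-- each sort: Z_s = Fin (Z s).

SSet : ℕ → Set
SSet t = Fin t → ℕ

Map : {t : ℕ} → SSet t → SSet t → Set
Map {t} Z A = (s : Fin t) → Fin (Z s) → Fin (A s)

NFun : {t : ℕ} → ℕ → SSet t → SSet t → Set
NFun {t} n A B = (s : Fin t) → (Fin n → Fin (A s)) → Fin (B s)

Mat : {t : ℕ} → SSet t → ℕ → SSet t → Set
Mat {t} Z n A = (s : Fin t) → Fin (Z s) → Fin n → Fin (A s)

col : {t n : ℕ} {Z A : SSet t} → Fin n → Mat Z n A → Map Z A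
col j M = λ s z → M s z j

_∘rows_ : {t n : ℕ} {Z A B : SSet t} → NFun n A B → Mat Z n A → Map Z B
(f ∘rows M) = λ s z → f s (M s z)

record Signature : Set where
  field
    nsorts : ℕ          -- τ = Fin nsorts
    nsyms  : ℕ          -- σ = Fin nsyms
    ar     : Fin nsyms → SSet nsorts
open Signature public

record ValuedStructure (Σ' : Signature) : Set where
  field
    dom    : SSet (nsorts Σ')
    interp : (φ : Fin (nsyms Σ')) → Map (ar Σ' φ) dom → ℚ̄
    feasNonempty : (φ : Fin (nsyms Σ')) →
                   Σ (Map (ar Σ' φ) dom) (λ x → IsFin (interp φ x))
open ValuedStructure public

record Atom (Σ' : Signature) (X : SSet (nsorts Σ')) : Set where
  field
    w    : ℚ
    w≥0  : 0ℚ ≤ w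
    φ    : Fin (nsyms Σ')
    args : Map (ar Σ' φ) X
open Atom public

Payoff : (Σ' : Signature) → SSet (nsorts Σ') → Set
Payoff Σ' X = List (Atom Σ' X)

weight : {Σ' : Signature} {X : SSet (nsorts Σ')} → Payoff Σ' X → ℚ
weight Φ = foldr (λ a acc → w a + acc) 0ℚ Φ

evalP : {Σ' : Signature} {X : SSet (nsorts Σ')} →
        Payoff Σ' X → (𝐀 : ValuedStructure Σ') → Map X (dom 𝐀) → ℚ̄
evalP Φ 𝐀 h =
  foldr (λ a acc → (w a ·̄ interp 𝐀 (φ a) (λ s i → h s (args a s i))) +̄ acc)
        (fin 0ℚ) Φ

PolFeas : {Σ' : Signature} → ValuedStructure Σ' → ValuedStructure Σ' → ℕ → Set
PolFeas {Σ'} 𝐀 𝐁 n =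
  Σ (NFun n (dom 𝐀) (dom 𝐁)) λ f →
    (φ : Fin (nsyms Σ')) (M : Mat (ar Σ' φ) n (dom 𝐀)) →
    ((j : Fin n) → IsFin (interp 𝐀 φ (col j M))) →
    IsFin (interp 𝐁 φ (f ∘rows M))

record Weighting {Σ' : Signature} (𝐀 𝐁 : ValuedStructure Σ') (n : ℕ) : Set where
  field
    Ωin  : Dist (Fin n)
    Ωout : Dist (PolFeas 𝐀 𝐁 n)
open Weighting public

Ωin[_,_] : {Σ' : Signature} {𝐀 𝐁 : ValuedStructure Σ'} {n : ℕ} →
           Weighting 𝐀 𝐁 n → (φ : Fin (nsyms Σ')) →
           Mat (ar Σ' φ) n (dom 𝐀) → ℚ̄
Ωin[_,_] {𝐀 = 𝐀} Ω φ M = 𝔼 (Ωin Ω) (λ j → interp 𝐀 φ (col j M))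

Ωout[_,_] : {Σ' : Signature} {𝐀 𝐁 : ValuedStructure Σ'} {n : ℕ} →
            Weighting 𝐀 𝐁 n → (φ : Fin (nsyms Σ')) →
            Mat (ar Σ' φ) n (dom 𝐀) → ℚ̄
Ωout[_,_] {𝐁 = 𝐁} Ω φ M = 𝔼 (Ωout Ω) (λ f → interp 𝐁 φ (proj₁ f ∘rows M))

IsPolymorphism : {Σ' : Signature} {𝐀 𝐁 : ValuedStructure Σ'} {n : ℕ} →
                 ℚ → ℚ → ℚ → Weighting 𝐀 𝐁 n → Set
IsPolymorphism {Σ'} {𝐀} {𝐁} {n} κ c s Ω =
  (φ : Fin (nsyms Σ')) (M : Mat (ar Σ' φ) n (dom 𝐀)) →
  ((j : Fin n) → IsFin (interp 𝐀 φ (col j M))) →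
  (Ωout[ Ω , φ ] M -ᵠ s) ≥̄ κ ·̄ (Ωin[ Ω , φ ] M -ᵠ c)

{-# OPTIONS --safe #-}
module Submission where

open import Defs
open import Data.Nat using (ℕ)
open import Data.Fin using (Fin)
open import Data.Rational using (ℚ; 0ℚ; _+_; _-_; -_; _*_; _≤_; _≟_; nonNegative)
open import Data.Rational.Properties
  using (+-*-commutativeRing; ≤-reflexive; +-mono-≤; +-monoˡ-≤; *-monoˡ-≤-nonNeg; *-zeroʳ; module ≤-Reasoning)
open import Data.Product using (_×_; _,_; proj₁; proj₂)
open import Data.List using (List; []; _∷_; foldr)
open import Data.List.Relation.Unary.All as All using (All; []; _∷_)
open import Level using (0ℓ)
open import Relation.Nullary.Decidable using (dec⇒maybe)
open import Relation.Binary.PropositionalEquality using (_≡_; refl; sym; trans; cong; cong₂; subst₂)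
open import Tactic.RingSolver using (solve-∀)
open import Tactic.RingSolver.Core.AlmostCommutativeRing using (AlmostCommutativeRing; fromCommutativeRing)

-- Every column is feasible for Φ, hence for each of its atoms φ_i(x_i), and the
-- feasibility polymorphisms in the support of Ω^out keep every atom feasible on
-- f ∘ rows(M). So all expectations involved are rational, and by linearity both
-- sides are w_i-weighted sums of Ω^in[φ_i, M(x_i, ·)] and Ω^out[φ_i, M(x_i, ·)].
-- The inequality is then the combination, with nonnegative weights w_i, of the
-- polymorphism inequalities for the pairs (φ_i, M(x_i, ·)); the threshold form
-- follows because κ ≥ 0.

-- The zero test lets the solver cancel terms such as c - c.
ℚ-ring : AlmostCommutativeRing 0ℓ 0ℓ
ℚ-ring = fromCommutativeRing +-*-commutativeRing (λ q → dec⇒maybe (0ℚ ≟ q))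

-- -∞ is sent to the junk value 0ℚ; toℚ is only applied to finite values.
toℚ : ℚ̄ → ℚ
toℚ (fin a) = a
toℚ -∞      = 0ℚ

IsFin⇒≡fin : ∀ {x} → IsFin x → x ≡ fin (toℚ x)
IsFin⇒≡fin (isFin a) = refl

IsFin-+̄⁻ : ∀ x y → IsFin (x +̄ y) → IsFin x × IsFin y
IsFin-+̄⁻ (fin a) (fin b) _ = isFin a , isFin b

IsFin-·̄⁻ : ∀ q x → IsFin (q ·̄ x) → IsFin x
IsFin-·̄⁻ q (fin a) _ = isFin a

fin≤⁻¹ : ∀ {a b} → fin a ≤̄ fin b → a ≤ b
fin≤⁻¹ (fin≤ a≤b) = a≤b

affine-threshold : ∀ {κ c s x y} → 0ℚ ≤ κ → κ * (x - c) ≤ y - s → c ≤ x → s ≤ y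
affine-threshold {κ} {c} {s} {x} {y} κ≥0 bound c≤x = begin
  s                ≡⟨ sym (cancel κ c s) ⟩
  κ * (c - c) + s  ≤⟨ +-monoˡ-≤ s (*-monoˡ-≤-nonNeg κ {{nonNegative κ≥0}} (+-monoˡ-≤ (- c) c≤x)) ⟩
  κ * (x - c) + s  ≤⟨ +-monoˡ-≤ s bound ⟩
  y - s + s        ≡⟨ subtract-add y s ⟩
  y                ∎
  where
  open ≤-Reasoning
  cancel : ∀ κ c s → κ * (c - c) + s ≡ s
  cancel = solve-∀ ℚ-ring
  subtract-add : ∀ y s → y - s + s ≡ y
  subtract-add = solve-∀ ℚ-ring

fin-affine-bound : ∀ {κ c s x y} {ex ey : ℚ̄} → 0ℚ ≤ κ → ex ≡ fin x → ey ≡ fin y →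
  κ * (x - c) ≤ y - s → (ey -ᵠ s ≥̄ κ ·̄ (ex -ᵠ c)) × (ex ≥̄ fin c → ey ≥̄ fin s)
fin-affine-bound κ≥0 refl refl bound =
  fin≤ bound , λ { (fin≤ c≤x) → fin≤ (affine-threshold κ≥0 bound c≤x) }

module _ {T : Set} where

  wsum : List (ℚ × T) → (T → ℚ) → ℚ
  wsum L g = foldr (λ p acc → proj₁ p * g (proj₂ p) + acc) 0ℚ L

  𝔼-fin : (D : Dist T) {g : T → ℚ̄} {g′ : T → ℚ} → (∀ x → g x ≡ fin (g′ x)) →
    𝔼 D g ≡ fin (wsum (support D) g′)
  𝔼-fin D {g} {g′} g≡g′ = go (support D)
    where
    go : (L : List (ℚ × T)) →
      foldr (λ p acc → (proj₁ p ·̄ g (proj₂ p)) +̄ acc) (fin 0ℚ) L ≡ fin (wsum L g′)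
    go []            = refl
    go ((q , x) ∷ L) = cong₂ (λ u v → (q ·̄ u) +̄ v) (g≡g′ x) (go L)

  wsum-zero : ∀ L → wsum L (λ _ → 0ℚ) ≡ 0ℚ
  wsum-zero []            = refl
  wsum-zero ((q , _) ∷ L) = cong₂ _+_ (*-zeroʳ q) (wsum-zero L)

  wsum-linear : ∀ L w (g h : T → ℚ) → wsum L (λ x → w * g x + h x) ≡ w * wsum L g + wsum L h
  wsum-linear []            w g h = sym (cong (_+ 0ℚ) (*-zeroʳ w))
  wsum-linear ((q , x) ∷ L) w g h =
    trans (cong (q * (w * g x + h x) +_) (wsum-linear L w g h)) (rearrange q w (g x) (h x) _ _)
    where
    rearrange : ∀ q w a b A B → q * (w * a + b) + (w * A + B) ≡ w * (q * a + A) + (q * b + B)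
    rearrange = solve-∀ ℚ-ring

module _ {Σ' : Signature} {X : SSet (nsorts Σ')} where

  payoffSum : Payoff Σ' X → (Atom Σ' X → ℚ) → ℚ
  payoffSum Φ v = foldr (λ a acc → w a * v a + acc) 0ℚ Φ

  wsum-payoffSum-comm : ∀ {T} (L : List (ℚ × T)) Φ (g : Atom Σ' X → T → ℚ) →
    wsum L (λ x → payoffSum Φ (λ a → g a x)) ≡ payoffSum Φ (λ a → wsum L (g a))
  wsum-payoffSum-comm L []      g = wsum-zero L
  wsum-payoffSum-comm L (a ∷ Φ) g =
    trans (wsum-linear L (w a) (g a) _) (cong (w a * wsum L (g a) +_) (wsum-payoffSum-comm L Φ g))

  payoffSum-affine-bound : ∀ {κ c s} Φ (x y : Atom Σ' X → ℚ) → All (λ a → κ * (x a - c) ≤ y a - s) Φ →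
    κ * (payoffSum Φ x - c * weight Φ) ≤ payoffSum Φ y - s * weight Φ
  payoffSum-affine-bound {κ} {c} {s} [] x y [] = ≤-reflexive (zero-weight κ c s)
    where
    zero-weight : ∀ κ c s → κ * (0ℚ - c * 0ℚ) ≡ 0ℚ - s * 0ℚ
    zero-weight = solve-∀ ℚ-ring
  payoffSum-affine-bound {κ} {c} {s} (a ∷ Φ) x y (bound ∷ bounds) = begin
    κ * (w a * x a + X′ - c * (w a + W))      ≡⟨ distribute κ (w a) (x a) X′ c W ⟩
    w a * (κ * (x a - c)) + κ * (X′ - c * W)  ≤⟨ +-mono-≤ (*-monoˡ-≤-nonNeg (w a) {{nonNegative (w≥0 a)}} bound)
                                                          (payoffSum-affine-bound {κ = κ} {c = c} {s = s} Φ x y bounds) ⟩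
    w a * (y a - s) + (Y′ - s * W)            ≡⟨ collect (w a) (y a) Y′ s W ⟩
    w a * y a + Y′ - s * (w a + W)            ∎
    where
    open ≤-Reasoning
    X′ Y′ W : ℚ
    X′ = payoffSum Φ x
    Y′ = payoffSum Φ y
    W  = weight Φ
    distribute : ∀ κ w x X c W → κ * (w * x + X - c * (w + W)) ≡ w * (κ * (x - c)) + κ * (X - c * W)
    distribute = solve-∀ ℚ-ring
    collect : ∀ w y Y s W → w * (y - s) + (Y - s * W) ≡ w * y + Y - s * (w + W)
    collect = solve-∀ ℚ-ring

  atomMatrix : ∀ {n} {A : SSet (nsorts Σ')} (a : Atom Σ' X) → Mat X n A → Mat (ar Σ' (φ a)) n A
  atomMatrix a M s i = M s (args a s i)

  module _ (𝐀 : ValuedStructure Σ') where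

    atomValue : Atom Σ' X → Map X (dom 𝐀) → ℚ̄
    atomValue a h = interp 𝐀 (φ a) (λ s i → h s (args a s i))

    evalP-IsFin⁻ : ∀ Φ h → IsFin (evalP Φ 𝐀 h) → All (λ a → IsFin (atomValue a h)) Φ
    evalP-IsFin⁻ []      _ _     = []
    evalP-IsFin⁻ (a ∷ Φ) h fin-Φ =
      let fin-a , fin-rest = IsFin-+̄⁻ _ _ fin-Φ
      in IsFin-·̄⁻ (w a) _ fin-a ∷ evalP-IsFin⁻ Φ h fin-rest

    evalP-fin : ∀ Φ h → All (λ a → IsFin (atomValue a h)) Φ →
      evalP Φ 𝐀 h ≡ fin (payoffSum Φ (λ a → toℚ (atomValue a h)))
    evalP-fin []      _ []              = refl
    evalP-fin (a ∷ Φ) h (fin-a ∷ fin-Φ) =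
      cong₂ (λ u v → (w a ·̄ u) +̄ v) (IsFin⇒≡fin fin-a) (evalP-fin Φ h fin-Φ)

    𝔼-evalP : ∀ {T} (D : Dist T) Φ (h : T → Map X (dom 𝐀)) →
      (∀ x → All (λ a → IsFin (atomValue a (h x))) Φ) →
      𝔼 D (λ x → evalP Φ 𝐀 (h x)) ≡ fin (payoffSum Φ (λ a → wsum (support D) (λ x → toℚ (atomValue a (h x)))))
    𝔼-evalP D Φ h feas =
      trans (𝔼-fin D (λ x → evalP-fin Φ (h x) (feas x))) (cong fin (wsum-payoffSum-comm (support D) Φ _))

module _ {Σ' : Signature} {𝐀 𝐁 : ValuedStructure Σ'} {n : ℕ} {κ c s : ℚ} (Ω : Weighting 𝐀 𝐁 n) where

  IsPolymorphism⇒wsum-bound : IsPolymorphism κ c s Ω → ∀ φ (M : Mat (ar Σ' φ) n (dom 𝐀)) →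
    (feasM : ∀ j → IsFin (interp 𝐀 φ (col j M))) →
    κ * (wsum (support (Ωin Ω)) (λ j → toℚ (interp 𝐀 φ (col j M))) - c)
      ≤ wsum (support (Ωout Ω)) (λ f → toℚ (interp 𝐁 φ (proj₁ f ∘rows M))) - s
  IsPolymorphism⇒wsum-bound isPol φ M feasM = fin≤⁻¹ (subst₂ _≥̄_
    (cong (_-ᵠ s) (𝔼-fin (Ωout Ω) (λ f → IsFin⇒≡fin (proj₂ f φ M feasM))))
    (cong (λ e → κ ·̄ (e -ᵠ c)) (𝔼-fin (Ωin Ω) (λ j → IsFin⇒≡fin (feasM j))))
    (isPol φ M feasM))

proposition8 : (Σ' : Signature) (𝐀 𝐁 : ValuedStructure Σ') (n : ℕ)
    (c s κ : ℚ) → 0ℚ ≤ κ →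
    (Ω : Weighting 𝐀 𝐁 n) → IsPolymorphism κ c s Ω →
    (X : SSet (nsorts Σ')) (Φ : Payoff Σ' X) (M : Mat X n (dom 𝐀)) →
    ((j : Fin n) → IsFin (evalP Φ 𝐀 (col j M))) →
    ((𝔼 (Ωout Ω) (λ f → evalP Φ 𝐁 (proj₁ f ∘rows M)) -ᵠ (s * weight Φ))
        ≥̄ κ ·̄ (𝔼 (Ωin Ω) (λ j → evalP Φ 𝐀 (col j M)) -ᵠ (c * weight Φ)))
    × (𝔼 (Ωin Ω) (λ j → evalP Φ 𝐀 (col j M)) ≥̄ fin (c * weight Φ) →
       𝔼 (Ωout Ω) (λ f → evalP Φ 𝐁 (proj₁ f ∘rows M)) ≥̄ fin (s * weight Φ))
proposition8 Σ' 𝐀 𝐁 n c s κ κ≥0 Ω isPol X Φ M feas =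
  fin-affine-bound κ≥0
    (𝔼-evalP 𝐀 (Ωin Ω) Φ (λ j → col j M) (λ j → All.map (λ feas-a → feas-a j) feasA))
    (𝔼-evalP 𝐁 (Ωout Ω) Φ (λ f → proj₁ f ∘rows M) feasB)
    (payoffSum-affine-bound {κ = κ} {c = c} {s = s} Φ _ _
      (All.map (λ {a} → IsPolymorphism⇒wsum-bound Ω isPol (φ a) (atomMatrix a M)) feasA))
  where
  feasA : All (λ a → ∀ j → IsFin (atomValue 𝐀 a (col j M))) Φ
  feasA = All.tabulate (λ a∈Φ j → All.lookup (evalP-IsFin⁻ 𝐀 Φ (col j M) (feas j)) a∈Φ)

  feasB : ∀ f → All (λ a → IsFin (atomValue 𝐁 a (proj₁ f ∘rows M))) Φ
  feasB f = All.map (λ {a} → proj₂ f (φ a) (atomMatrix a M)) feasA
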